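{- For $1<R\le 3/2$, the greedy algorithm which, in each round $i$, sets $B_i=B_{i-1}\cup\{e_i\}$ if $s(B_{i-1}\cup\{e_i\})\le R$ and $B_i=B_{i-1}$ otherwise (starting from $B_0=\emptyset$), is $\frac{1}{R-1}$-competitive for the proportional\&non-removable online knapsack problem with a buffer of capacity $R$.
   Context: Online knapsack problem with a resource buffer: there is a knapsack of capacity $1$ and a buffer of capacity $R\ge 1$. Items $e_1,\dots,e_n$ arrive one by one; each item $e$ has size $0<s(e)\le 1$ and value $v(e)\ge 0$; $s(B),v(B)$ denote sums over a set $B$. A deterministic online algorithm maintains buffer contents $B_0=\emptyset,B_1,\dots,B_n$, with $B_i$ chosen after seeing only $e_1,\dots,e_i$, $B_i\subseteq B_{i-1}\cup\{e_i\}$, $s(B_i)\le R$; in the non-removable setting additionally $B_{i-1}\subseteq B_i$. $\mathrm{ALG}(I)=\max\{v(B)\mid B\subseteq B_n,\ s(B)\le 1\}$, $\mathrm{OPT}(I)=\max\{v(B)\mid B\subseteq\{e_1,\dots,e_n\},\ s(B)\le 1\}$. "Proportional" means $v(e)=s(e)$ for every item. An algorithm is $c$-competitive if $\mathrm{OPT}(I)\le c\cdot\mathrm{ALG}(I)$ for every input $I$.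
   Formalization: The item sizes s(e) and the buffer capacity R take values in the rationals. -}

module Defs where

open import Data.Rational using (ℚ; 0ℚ; _+_; _≤_; _<_)
open import Data.Rational.Properties using (_≤?_)
open import Data.List using (List; []; _∷_; _++_; [_]; foldr; foldl)
open import Data.List.Relation.Unary.All using (All)
open import Data.Product using (_×_)
open import Relation.Nullary using (yes; no)

-- An input instance of the proportional problem: a list of items (in
-- arrival order), each item given by its size s(e) ∈ ℚ; its value is
-- v(e) = s(e).  Items are identified by position, so sub-collections of
-- items are sublists.

sizeOf : List ℚ → ℚ
sizeOf = foldr _+_ 0ℚ

ValidSize : ℚ → Set
ValidSize s = (0ℚ < s) × (s ≤ Data.Rational.1ℚ)

greedyStep : ℚ → List ℚ → ℚ → List ℚ
greedyStep R B e with sizeOf (B ++ [ e ]) ≤? R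
... | yes _ = B ++ [ e ]
... | no  _ = B

greedy : ℚ → List ℚ → List ℚ
greedy R items = foldl (greedyStep R) [] items

-- Either greedy accepted every item, so the optimal set S lies in its buffer, or
-- some item e ≤ 1 was rejected: then R < s(B) + s(e) ≤ s(B) + 1 for the buffer B
-- at that moment, and the buffer never shrinks, so it ends with size > R - 1.
-- Since R - 1 ≤ ½ and all items are ≤ 1, such a buffer contains a sub-collection
-- T with R - 1 ≤ s(T) ≤ 1: a single item of size ≥ R - 1 if there is one, and
-- otherwise the shortest suffix of size ≥ R - 1, whose size is < 2(R - 1) ≤ 1.
-- Finally (R - 1) s(S) ≤ R - 1 ≤ s(T) because s(S) ≤ 1.
{-# OPTIONS --safe #-}
module Submission where

open import Defs
open import Data.Rational using (ℚ; 0ℚ; 1ℚ; ½; _+_; _-_; -_; _*_; _≤_; _<_; nonNegative)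
open import Data.Rational.Properties
  using (_≤?_; ≤-refl; ≤-trans; <⇒≤; ≰⇒>; <-≤-trans; nonNegative⁻¹; +-mono-≤; +-monoˡ-≤; +-monoʳ-≤;
         +-monoˡ-<; +-mono-<; +-assoc; +-identityˡ; +-identityʳ; *-identityˡ; *-identityʳ;
         *-monoˡ-≤-nonNeg; *-monoʳ-≤-nonNeg; +-0-group; module ≤-Reasoning)
open import Algebra.Properties.Group +-0-group using (//-rightDividesʳ)
open import Data.List using (List; []; _∷_; _++_; [_]; foldl)
open import Data.List.Properties using (++-identityʳ; ++-assoc)
open import Data.List.Relation.Unary.All as All using (All; []; _∷_)
open import Data.List.Relation.Binary.Sublist.Propositional using (_⊆_; _∷_; _∷ʳ_; ⊆-refl; ⊆-trans; minimum)
open import Data.List.Relation.Binary.Sublist.Propositional.Properties using (++⁺; All-resp-⊆)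
open import Data.Product using (Σ; _×_; _,_; proj₁; proj₂)
open import Data.Sum using (_⊎_; inj₁; inj₂; [_,_]′; map₁)
open import Function using (_∘_)
open import Relation.Nullary using (yes; no)
open import Relation.Nullary.Decidable using (from-yes)
open import Relation.Binary.PropositionalEquality using (_≡_; refl; sym; trans; cong; subst)

p<q+r⇒p-r<q : ∀ {p q r} → p < q + r → p - r < q
p<q+r⇒p-r<q {q = q} {r} p<q+r = subst (_ <_) (//-rightDividesʳ r q) (+-monoˡ-< (- r) p<q+r)

p≤1⇒p*q≤q : ∀ {p q} → 0ℚ ≤ q → p ≤ 1ℚ → p * q ≤ q
p≤1⇒p*q≤q {p} {q} 0≤q p≤1 = begin
  p * q   ≤⟨ *-monoʳ-≤-nonNeg q {{nonNegative 0≤q}} p≤1 ⟩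
  1ℚ * q  ≡⟨ *-identityˡ q ⟩
  q       ∎
  where open ≤-Reasoning

q≤1⇒p*q≤p : ∀ {p q} → 0ℚ ≤ p → q ≤ 1ℚ → p * q ≤ p
q≤1⇒p*q≤p {p} {q} 0≤p q≤1 = begin
  p * q   ≤⟨ *-monoˡ-≤-nonNeg p {{nonNegative 0≤p}} q≤1 ⟩
  p * 1ℚ  ≡⟨ *-identityʳ p ⟩
  p       ∎
  where open ≤-Reasoning

sizeOf-++ : ∀ xs ys → sizeOf (xs ++ ys) ≡ sizeOf xs + sizeOf ys
sizeOf-++ []       ys = sym (+-identityˡ (sizeOf ys))
sizeOf-++ (x ∷ xs) ys = trans (cong (x +_) (sizeOf-++ xs ys)) (sym (+-assoc x (sizeOf xs) (sizeOf ys)))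

sizeOf-∷ʳ : ∀ xs x → sizeOf (xs ++ [ x ]) ≡ sizeOf xs + x
sizeOf-∷ʳ xs x = trans (sizeOf-++ xs [ x ]) (cong (sizeOf xs +_) (+-identityʳ x))

sizeOf-nonNeg : ∀ {xs} → All (0ℚ ≤_) xs → 0ℚ ≤ sizeOf xs
sizeOf-nonNeg []           = nonNegative⁻¹ 0ℚ
sizeOf-nonNeg (0≤x ∷ 0≤xs) = +-mono-≤ 0≤x (sizeOf-nonNeg 0≤xs)

sublist-of-size-between : ∀ c → c + c ≤ 1ℚ → ∀ G → All (_≤ 1ℚ) G → c ≤ sizeOf G →
  Σ (List ℚ) λ T → T ⊆ G × sizeOf T ≤ 1ℚ × c ≤ sizeOf T
sublist-of-size-between c c+c≤1 []      []           c≤0 = [] , ⊆-refl , nonNegative⁻¹ 1ℚ , c≤0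
sublist-of-size-between c c+c≤1 (x ∷ G) (x≤1 ∷ G≤1) c≤x+G with c ≤? x | c ≤? sizeOf G
... | yes c≤x | _ = [ x ] , refl ∷ minimum G , subst (_≤ 1ℚ) x≡[x] x≤1 , subst (c ≤_) x≡[x] c≤x
  where
  x≡[x] : x ≡ sizeOf [ x ]
  x≡[x] = sym (+-identityʳ x)
... | no _ | yes c≤G =
  let T , T⊆G , T≤1 , c≤T = sublist-of-size-between c c+c≤1 G G≤1 c≤G in T , x ∷ʳ T⊆G , T≤1 , c≤T
... | no c≰x | no c≰G = x ∷ G , ⊆-refl , <⇒≤ (<-≤-trans (+-mono-< (≰⇒> c≰x) (≰⇒> c≰G)) c+c≤1) , c≤x+G

module _ (R : ℚ) where

  greedy-⊆ : ∀ B es → foldl (greedyStep R) B es ⊆ B ++ es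
  greedy-⊆ B []       = subst (B ⊆_) (sym (++-identityʳ B)) ⊆-refl
  greedy-⊆ B (e ∷ es) with sizeOf (B ++ [ e ]) ≤? R
  ... | yes _ = subst (foldl (greedyStep R) (B ++ [ e ]) es ⊆_) (++-assoc B [ e ] es)
                  (greedy-⊆ (B ++ [ e ]) es)
  ... | no  _ = ⊆-trans (greedy-⊆ B es) (++⁺ ⊆-refl (e ∷ʳ ⊆-refl))

  sizeOf-greedy-≥ : ∀ B {es} → All (0ℚ ≤_) es → sizeOf B ≤ sizeOf (foldl (greedyStep R) B es)
  sizeOf-greedy-≥ B [] = ≤-refl
  sizeOf-greedy-≥ B {e ∷ es} (0≤e ∷ 0≤es) with sizeOf (B ++ [ e ]) ≤? R
  ... | no  _ = sizeOf-greedy-≥ B 0≤es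
  ... | yes _ = begin
    sizeOf B                                          ≡⟨ +-identityʳ (sizeOf B) ⟨
    sizeOf B + 0ℚ                                     ≤⟨ +-monoʳ-≤ (sizeOf B) 0≤e ⟩
    sizeOf B + e                                      ≡⟨ sizeOf-∷ʳ B e ⟨
    sizeOf (B ++ [ e ])                               ≤⟨ sizeOf-greedy-≥ (B ++ [ e ]) 0≤es ⟩
    sizeOf (foldl (greedyStep R) (B ++ [ e ]) es)     ∎
    where open ≤-Reasoning

  greedy-accepts-all-or-exceeds : ∀ B {es} → All (0ℚ ≤_) es → All (_≤ 1ℚ) es →
    foldl (greedyStep R) B es ≡ B ++ es ⊎ R - 1ℚ < sizeOf (foldl (greedyStep R) B es)
  greedy-accepts-all-or-exceeds B [] [] = inj₁ (sym (++-identityʳ B))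
  greedy-accepts-all-or-exceeds B {e ∷ es} (0≤e ∷ 0≤es) (e≤1 ∷ es≤1) with sizeOf (B ++ [ e ]) ≤? R
  ... | yes _ = map₁ (λ eq → trans eq (++-assoc B [ e ] es))
                     (greedy-accepts-all-or-exceeds (B ++ [ e ]) 0≤es es≤1)
  ... | no B+e≰R = inj₂ (<-≤-trans (p<q+r⇒p-r<q R<B+1) (sizeOf-greedy-≥ B 0≤es))
    where
    open ≤-Reasoning
    R<B+1 : R < sizeOf B + 1ℚ
    R<B+1 = begin-strict
      R                    <⟨ ≰⇒> B+e≰R ⟩
      sizeOf (B ++ [ e ])  ≡⟨ sizeOf-∷ʳ B e ⟩
      sizeOf B + e         ≤⟨ +-monoʳ-≤ (sizeOf B) e≤1 ⟩
      sizeOf B + 1ℚ        ∎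

theorem4 : (R : ℚ) → 1ℚ < R → R ≤ 1ℚ + ½ →
    (items : List ℚ) → All ValidSize items →
    (S : List ℚ) → S ⊆ items → sizeOf S ≤ 1ℚ →
    Σ (List ℚ) λ T → T ⊆ greedy R items × sizeOf T ≤ 1ℚ ×
      (R - 1ℚ) * sizeOf S ≤ sizeOf T
theorem4 R 1<R R≤3/2 items valid S S⊆items sS≤1 =
  [ all-accepted , buffer-exceeds ]′ (greedy-accepts-all-or-exceeds R [] nonNeg ≤1)
  where
  Goal : Set
  Goal = Σ (List ℚ) λ T → T ⊆ greedy R items × sizeOf T ≤ 1ℚ × (R - 1ℚ) * sizeOf S ≤ sizeOf T

  nonNeg : All (0ℚ ≤_) items
  nonNeg = All.map (<⇒≤ ∘ proj₁) valid

  ≤1 : All (_≤ 1ℚ) items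
  ≤1 = All.map proj₂ valid

  -- The closed terms 1ℚ - 1ℚ and (1ℚ + ½) - 1ℚ normalise to 0ℚ and ½.
  0≤R-1 : 0ℚ ≤ R - 1ℚ
  0≤R-1 = <⇒≤ (+-monoˡ-< (- 1ℚ) 1<R)

  R-1≤½ : R - 1ℚ ≤ ½
  R-1≤½ = +-monoˡ-≤ (- 1ℚ) R≤3/2

  all-accepted : greedy R items ≡ items → Goal
  all-accepted G≡items = S , subst (S ⊆_) (sym G≡items) S⊆items , sS≤1 ,
    p≤1⇒p*q≤q (sizeOf-nonNeg (All-resp-⊆ S⊆items nonNeg)) (≤-trans R-1≤½ (from-yes (½ ≤? 1ℚ)))

  buffer-exceeds : R - 1ℚ < sizeOf (greedy R items) → Goal
  buffer-exceeds R-1<G =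
    let T , T⊆G , T≤1 , R-1≤T = sublist-of-size-between (R - 1ℚ) (+-mono-≤ R-1≤½ R-1≤½)
                                  (greedy R items) (All-resp-⊆ (greedy-⊆ R [] items) ≤1) (<⇒≤ R-1<G)
    in T , T⊆G , T≤1 , ≤-trans (q≤1⇒p*q≤p 0≤R-1 sS≤1) R-1≤T
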